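{- Let $k$ be a non-negative integer. Suppose that $\ell(n) \le 2kn+n-k^2-k$ for every positive integer $n$. Then every Latin square of order $n$ has a partial transversal of length $n-k$.
   Context: An array of order $n$ is an $n\times n$ array of symbols; an entry is a triple $(i,j,A_{ij})$ with $A_{ij}$ the symbol in cell $(i,j)$. A partial transversal of length $k$ is a set of $k$ entries, no two of which agree in any of their three coordinates (row, column, symbol). A transversal of an $n\times n$ array is a partial transversal of length $n$. An array is Latin if no symbol appears more than once in any row or any column; a Latin square of order $n$ is a Latin array of order $n$ with exactly $n$ distinct symbols. For each positive integer $n$, $\ell(n)$ denotes the least positive integer such that $\ell(n)\ge n$ and every $n\times n$ Latin array with at least $\ell(n)$ distinct symbols contains a transversal. -}

module Defs where

open import Data.Nat using (ℕ; _≤_; _+_; _*_)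
open import Data.Fin using (Fin)
open import Data.Product using (_×_; Σ; ∃; proj₁; proj₂)
open import Relation.Nullary using (¬_)
open import Relation.Binary.PropositionalEquality using (_≡_)
open import Function.Definitions using (Injective)

-- An array of order n: an n × n array of symbols. Symbols are taken from ℕ
-- (any finite symbol set can be relabelled injectively into ℕ).
Array : ℕ → Set
Array n = Fin n → Fin n → ℕ

IsLatin : ∀ {n} → Array n → Set
IsLatin {n} A =
  (∀ (i j j′ : Fin n) → A i j ≡ A i j′ → j ≡ j′) ×
  (∀ (i i′ j : Fin n) → A i j ≡ A i′ j → i ≡ i′)

AtLeastSymbols : ∀ {n} → ℕ → Array n → Set
AtLeastSymbols {n} m A =
  Σ (Fin m → Fin n) λ r → Σ (Fin m → Fin n) λ c →
    Injective _≡_ _≡_ (λ t → A (r t) (c t))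

ExactlySymbols : ∀ {n} → ℕ → Array n → Set
ExactlySymbols m A = AtLeastSymbols m A × ¬ AtLeastSymbols (m + 1) A

IsLatinSquare : ∀ {n} → Array n → Set
IsLatinSquare {n} A = IsLatin A × ExactlySymbols n A

HasPartialTransversal : ∀ {n} → ℕ → Array n → Set
HasPartialTransversal {n} L A =
  Σ (Fin L → Fin n) λ r → Σ (Fin L → Fin n) λ c →
    Injective _≡_ _≡_ r × Injective _≡_ _≡_ c ×
    Injective _≡_ _≡_ (λ t → A (r t) (c t))

HasTransversal : ∀ {n} → Array n → Set
HasTransversal {n} A = HasPartialTransversal n A

EllProperty : ℕ → ℕ → Set
EllProperty n m =
  ∀ (A : Array n) → IsLatin A → AtLeastSymbols m A → HasTransversal A

IsEll : ℕ → ℕ → Set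
IsEll n m =
  1 ≤ m × n ≤ m × EllProperty n m ×
  (∀ m′ → 1 ≤ m′ → n ≤ m′ → EllProperty n m′ → m ≤ m′)

module Submission where

-- Border the Latin square A by k new rows and k new columns: the core keeps the
-- symbols of A (doubled, so they are even) and every border cell receives its own
-- odd symbol.  The result is a Latin array of order n + k with n + 2kn + k²
-- symbols, which by hypothesis is at least ℓ(n + k), so it has a transversal.
-- At most k entries of that transversal lie in the new rows and at most k in the
-- new columns, so at least n − k of them lie in the core and form a partial
-- transversal of A.

open import Defs
open import Data.Nat using (ℕ; zero; suc; _≤_; _+_; _*_; _∸_; z≤n; s≤s)
open import Data.Nat.Properties
open import Data.Nat.Solver using (module +-*-Solver)
open import Data.Fin
  using (Fin; zero; suc; toℕ; splitAt; join; combine; remQuot; inject≤; punchOut; _↑ˡ_; _↑ʳ_)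
open import Data.Fin.Properties
  using (toℕ-injective; ↑ˡ-injective; ↑ʳ-injective; splitAt-↑ˡ; splitAt-↑ʳ; splitAt⁻¹-↑ˡ;
         join-splitAt; combine-remQuot; combine-injective; inject≤-injective; punchOut-injective)
  renaming (0≢1+n to zero≢suc; suc-injective to Fin-suc-injective)
open import Data.Product using (_×_; ∃; ∃₂; Σ; _,_; proj₁; proj₂; uncurry)
import Data.Product as Product
open import Data.Product.Properties using (×-≡,≡→≡; ×-≡,≡←≡; ,-injectiveˡ; ,-injectiveʳ)
open import Data.Sum using (_⊎_; inj₁; inj₂; [_,_]′)
open import Data.Sum.Properties using (inj₂-injective; [,]-∘)
open import Function using (id; _∘_)
open import Function.Definitions using (Injective)
open import Relation.Binary.PropositionalEquality
open import Relation.Nullary using (contradiction)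

∸-suc-≤ : ∀ m n → m ∸ n ≤ suc (m ∸ suc n)
∸-suc-≤ zero    n       = ≤-trans (m∸n≤m 0 n) z≤n
∸-suc-≤ (suc m) zero    = ≤-refl
∸-suc-≤ (suc m) (suc n) = ∸-suc-≤ m n

↑ˡ≢↑ʳ : ∀ {m n} (i : Fin m) (j : Fin n) → i ↑ˡ n ≢ m ↑ʳ j
↑ˡ≢↑ʳ {m} {n} i j eq
  with () ← trans (sym (splitAt-↑ˡ m i n)) (trans (cong (splitAt m) eq) (splitAt-↑ʳ m n j))

splitAt-injective : ∀ m {n} → Injective _≡_ _≡_ (splitAt m {n})
splitAt-injective m {n} {i} {j} eq =
  trans (sym (join-splitAt m n i)) (trans (cong (join m n) eq) (join-splitAt m n j))

remQuot-injective : ∀ {m} n → Injective _≡_ _≡_ (remQuot {m} n)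
remQuot-injective {m} n {i} {j} eq =
  trans (sym (combine-remQuot {m} n i)) (trans (cong (uncurry combine) eq) (combine-remQuot {m} n j))

[,]-injective : ∀ {A B C : Set} {f : A → C} {g : B → C} →
  Injective _≡_ _≡_ f → Injective _≡_ _≡_ g → (∀ a b → f a ≢ g b) →
  Injective _≡_ _≡_ [ f , g ]′
[,]-injective f-inj g-inj f≢g {inj₁ a} {inj₁ a′} eq = cong inj₁ (f-inj eq)
[,]-injective f-inj g-inj f≢g {inj₁ a} {inj₂ b}  eq = contradiction eq (f≢g a b)
[,]-injective f-inj g-inj f≢g {inj₂ b} {inj₁ a}  eq = contradiction (sym eq) (f≢g a b)
[,]-injective f-inj g-inj f≢g {inj₂ b} {inj₂ b′} eq = cong inj₂ (g-inj eq)

[,]∘splitAt-injective : ∀ {C : Set} {m n} {f : Fin m → C} {g : Fin n → C} →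
  Injective _≡_ _≡_ f → Injective _≡_ _≡_ g → (∀ a b → f a ≢ g b) →
  Injective _≡_ _≡_ ([ f , g ]′ ∘ splitAt m)
[,]∘splitAt-injective {m = m} f-inj g-inj f≢g =
  splitAt-injective m ∘ [,]-injective f-inj g-inj f≢g

punchOutLabel : ∀ {X : Set} {m} (u : Fin (suc m)) (y : X ⊎ Fin (suc m)) → y ≢ inj₂ u → X ⊎ Fin m
punchOutLabel u (inj₁ x) _   = inj₁ x
punchOutLabel u (inj₂ v) v≢u = inj₂ (punchOut (v≢u ∘ cong inj₂ ∘ sym))

punchOutLabel-injective : ∀ {X : Set} {m} (u : Fin (suc m)) (y y′ : X ⊎ Fin (suc m)) p p′ →
  punchOutLabel u y p ≡ punchOutLabel u y′ p′ → y ≡ y′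
punchOutLabel-injective u (inj₁ x) (inj₁ x′) p p′ refl = refl
punchOutLabel-injective u (inj₂ v) (inj₂ v′) p p′ eq =
  cong inj₂ (punchOut-injective {i = u} _ _ (inj₂-injective eq))

punchOutLabel-inj₁ : ∀ {X : Set} {m} (u : Fin (suc m)) (y : X ⊎ Fin (suc m)) p {x} →
  punchOutLabel u y p ≡ inj₁ x → y ≡ inj₁ x
punchOutLabel-inj₁ u (inj₁ x) p refl = refl

Inj₁Preimages : ∀ {X : Set} {N m} → (Fin N → X ⊎ Fin m) → ℕ → Set
Inj₁Preimages {N = N} h L =
  Σ (Fin L → Fin N) λ f → Injective _≡_ _≡_ f × (∀ s → ∃ λ x → h (f s) ≡ inj₁ x)

select-inj₁ : ∀ {X : Set} {N m} (h : Fin N → X ⊎ Fin m) → Injective _≡_ _≡_ h →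
  Inj₁Preimages h (N ∸ m)
select-inj₁ {X} {m = zero} h _ = id , id , λ t → fromInj₁ (h t)
  where
  fromInj₁ : (y : X ⊎ Fin 0) → ∃ λ x → y ≡ inj₁ x
  fromInj₁ (inj₁ x) = x , refl
select-inj₁ {N = zero} {suc m} h _ = (λ ()) , (λ { {()} }) , (λ ())
select-inj₁ {X} {suc N} {suc m} h h-inj with h zero in h0≡
... | inj₁ x₀ = f ∘ widen , inject≤-injective _ _ _ _ ∘ f-inj , f-inj₁ ∘ widen
  where
  rest : Inj₁Preimages (h ∘ suc) (N ∸ suc m)
  rest = select-inj₁ (h ∘ suc) (Fin-suc-injective ∘ h-inj)
  widen : Fin (N ∸ m) → Fin (suc (N ∸ suc m))
  widen s = inject≤ s (∸-suc-≤ N m)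
  f : Fin (suc (N ∸ suc m)) → Fin (suc N)
  f zero    = zero
  f (suc s) = suc (proj₁ rest s)
  f-inj : Injective _≡_ _≡_ f
  f-inj {zero}  {zero}  _  = refl
  f-inj {suc s} {suc t} eq = cong suc (proj₁ (proj₂ rest) (Fin-suc-injective eq))
  f-inj₁ : ∀ s → ∃ λ x → h (f s) ≡ inj₁ x
  f-inj₁ zero    = x₀ , h0≡
  f-inj₁ (suc s) = proj₂ (proj₂ rest) s
... | inj₂ u = suc ∘ proj₁ rest , proj₁ (proj₂ rest) ∘ Fin-suc-injective ,
               Product.map₂ (punchOutLabel-inj₁ u _ _) ∘ proj₂ (proj₂ rest)
  where
  h′ : Fin N → X ⊎ Fin m
  h′ t = punchOutLabel u (h (suc t)) (λ eq → zero≢suc (h-inj (trans h0≡ (sym eq))))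
  rest : Inj₁Preimages h′ (N ∸ m)
  rest = select-inj₁ h′ (λ eq → Fin-suc-injective (h-inj (punchOutLabel-injective u _ _ _ _ eq)))

↑ˡ-preimages : ∀ {L n k} (r : Fin L → Fin (n + k)) → Injective _≡_ _≡_ r →
  Σ (Fin (L ∸ k) → Fin L) λ f → Injective _≡_ _≡_ f × (∀ s → ∃ λ a → a ↑ˡ k ≡ r (f s))
↑ˡ-preimages {n = n} r r-inj with select-inj₁ (splitAt n ∘ r) (r-inj ∘ splitAt-injective n)
... | f , f-inj , f-inj₁ = f , f-inj , Product.map₂ splitAt⁻¹-↑ˡ ∘ f-inj₁

atLeastSymbols-+ : ∀ {N m₁ m₂} {B : Array N}
  (cell₁ : Fin m₁ → Fin N × Fin N) (cell₂ : Fin m₂ → Fin N × Fin N) →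
  Injective _≡_ _≡_ (uncurry B ∘ cell₁) → Injective _≡_ _≡_ (uncurry B ∘ cell₂) →
  (∀ s t → uncurry B (cell₁ s) ≢ uncurry B (cell₂ t)) → AtLeastSymbols (m₁ + m₂) B
atLeastSymbols-+ {N} {m₁} {m₂} {B} cell₁ cell₂ distinct₁ distinct₂ disjoint =
  proj₁ ∘ cell , proj₂ ∘ cell , λ {s} {t} eq →
    [,]∘splitAt-injective distinct₁ distinct₂ disjoint
      (trans (sym ([,]-∘ (uncurry B) (splitAt m₁ s))) (trans eq ([,]-∘ (uncurry B) (splitAt m₁ t))))
  where
  cell : Fin (m₁ + m₂) → Fin N × Fin N
  cell = [ cell₁ , cell₂ ]′ ∘ splitAt m₁

atLeastSymbols-≤ : ∀ {N m m′} {B : Array N} → m ≤ m′ → AtLeastSymbols m′ B → AtLeastSymbols m B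
atLeastSymbols-≤ m≤m′ (r , c , distinct) =
  (λ t → r (inject≤ t m≤m′)) , (λ t → c (inject≤ t m≤m′)) ,
  inject≤-injective _ _ _ _ ∘ distinct

empty-partialTransversal : ∀ {n} (A : Array n) → HasPartialTransversal 0 A
empty-partialTransversal A = (λ ()) , (λ ()) , (λ { {()} }) , (λ { {()} }) , (λ { {()} })

partialTransversal-comap : ∀ {n L} {A B : Array n} (φ : ℕ → ℕ) → (∀ a b → B a b ≡ φ (A a b)) →
  HasPartialTransversal L B → HasPartialTransversal L A
partialTransversal-comap {A = A} {B} φ B≡φA (r , c , r-inj , c-inj , distinct) =
  r , c , r-inj , c-inj , λ {s} {t} eq →
    distinct (trans (B≡φA (r s) (c s)) (trans (cong φ eq) (sym (B≡φA (r t) (c t)))))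

topLeft : ∀ {n} k → Array (n + k) → Array n
topLeft k B a b = B (a ↑ˡ k) (b ↑ˡ k)

-- Discard the entries in the last k rows, then those in the last k columns.
partialTransversal-topLeft : ∀ {n k L} (B : Array (n + k)) →
  HasPartialTransversal L B → HasPartialTransversal (L ∸ k ∸ k) (topLeft k B)
partialTransversal-topLeft {n} {k} {L} B (r , c , r-inj , c-inj , distinct) =
  let f , f-inj , row-of = ↑ˡ-preimages r r-inj
      g , g-inj , col-of = ↑ˡ-preimages (c ∘ f) (f-inj ∘ c-inj)
      row : Fin (L ∸ k ∸ k) → Fin n
      row s = proj₁ (row-of (g s))
      col : Fin (L ∸ k ∸ k) → Fin n
      col s = proj₁ (col-of s)
      row≡ : ∀ s → row s ↑ˡ k ≡ r (f (g s))
      row≡ s = proj₂ (row-of (g s))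
      col≡ : ∀ s → col s ↑ˡ k ≡ c (f (g s))
      col≡ s = proj₂ (col-of s)
      entry≡ : ∀ s → topLeft k B (row s) (col s) ≡ B (r (f (g s))) (c (f (g s)))
      entry≡ s = cong₂ B (row≡ s) (col≡ s)
  in row , col ,
     (λ {s} {t} eq → g-inj (f-inj (r-inj
       (trans (sym (row≡ s)) (trans (cong (_↑ˡ k) eq) (row≡ t)))))) ,
     (λ {s} {t} eq → g-inj (f-inj (c-inj
       (trans (sym (col≡ s)) (trans (cong (_↑ˡ k) eq) (col≡ t)))))) ,
     (λ {s} {t} eq → g-inj (f-inj (distinct
       (trans (sym (entry≡ s)) (trans eq (entry≡ t))))))

oddCode : ∀ {N} → Fin N × Fin N → ℕ
oddCode (i , j) = suc (2 * toℕ (combine i j))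

oddCode-injective : ∀ {N} → Injective _≡_ _≡_ (oddCode {N})
oddCode-injective {x = i , j} {i′ , j′} eq =
  ×-≡,≡→≡ (combine-injective i j i′ j′ (toℕ-injective (*-cancelˡ-≡ _ _ 2 (suc-injective eq))))

module _ {n} (A : Array n) (k : ℕ) where

  bordered : Array (n + k)
  bordered i j = symbol (splitAt n i) (splitAt n j)
    where
    symbol : Fin n ⊎ Fin k → Fin n ⊎ Fin k → ℕ
    symbol (inj₁ a) (inj₁ b) = 2 * A a b
    symbol _        _        = oddCode (i , j)

  bordered-core : ∀ a b → bordered (a ↑ˡ k) (b ↑ˡ k) ≡ 2 * A a b
  bordered-core a b rewrite splitAt-↑ˡ n a k | splitAt-↑ˡ n b k = refl

  bordered-entry : ∀ i j →
    (∃₂ λ a b → a ↑ˡ k ≡ i × b ↑ˡ k ≡ j × bordered i j ≡ 2 * A a b) ⊎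
    bordered i j ≡ oddCode (i , j)
  bordered-entry i j with splitAt n i in i≡ | splitAt n j in j≡
  ... | inj₁ a | inj₁ b = inj₁ (a , b , splitAt⁻¹-↑ˡ i≡ , splitAt⁻¹-↑ˡ j≡ , refl)
  ... | inj₁ _ | inj₂ _ = inj₂ refl
  ... | inj₂ _ | _      = inj₂ refl

  bordered-repeat : ∀ {i j i′ j′} → bordered i j ≡ bordered i′ j′ →
    (i ≡ i′ × j ≡ j′) ⊎
    (∃₂ λ a b → ∃₂ λ a′ b′ →
       a ↑ˡ k ≡ i × b ↑ˡ k ≡ j × a′ ↑ˡ k ≡ i′ × b′ ↑ˡ k ≡ j′ × A a b ≡ A a′ b′)
  bordered-repeat {i} {j} {i′} {j′} eq with bordered-entry i j | bordered-entry i′ j′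
  ... | inj₁ (a , b , a≡ , b≡ , e) | inj₁ (a′ , b′ , a′≡ , b′≡ , e′) =
    inj₂ (a , b , a′ , b′ , a≡ , b≡ , a′≡ , b′≡ , *-cancelˡ-≡ _ _ 2 (trans (sym e) (trans eq e′)))
  ... | inj₁ (a , b , _ , _ , e) | inj₂ o′ =
    contradiction (trans (sym e) (trans eq o′)) (even≢odd (A a b) (toℕ (combine i′ j′)))
  ... | inj₂ o | inj₁ (a′ , b′ , _ , _ , e′) =
    contradiction (trans (sym e′) (trans (sym eq) o)) (even≢odd (A a′ b′) (toℕ (combine i j)))
  ... | inj₂ o | inj₂ o′ = inj₁ (×-≡,≡←≡ (oddCode-injective (trans (sym o) (trans eq o′))))

  bordered-isLatin : IsLatin A → IsLatin bordered
  bordered-isLatin (rows , cols) = rows′ , cols′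
    where
    rows′ : ∀ i j j′ → bordered i j ≡ bordered i j′ → j ≡ j′
    rows′ i j j′ eq with bordered-repeat eq
    ... | inj₁ (_ , j≡j′) = j≡j′
    ... | inj₂ (a , b , a′ , b′ , refl , refl , a′≡a , refl , A≡)
      with refl ← ↑ˡ-injective k a′ a a′≡a = cong (_↑ˡ k) (rows a b b′ A≡)
    cols′ : ∀ i i′ j → bordered i j ≡ bordered i′ j → i ≡ i′
    cols′ i i′ j eq with bordered-repeat eq
    ... | inj₁ (i≡i′ , _) = i≡i′
    ... | inj₂ (a , b , a′ , b′ , refl , refl , refl , b′≡b , A≡)
      with refl ← ↑ˡ-injective k b′ b b′≡b = cong (_↑ˡ k) (cols a a′ b A≡)

  bottomCell : Fin (k * (n + k)) → Fin (n + k) × Fin (n + k)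
  bottomCell = Product.map₁ (n ↑ʳ_) ∘ remQuot (n + k)

  rightCell : Fin (n * k) → Fin (n + k) × Fin (n + k)
  rightCell = Product.map (_↑ˡ k) (n ↑ʳ_) ∘ remQuot k

  borderCell : Fin (k * (n + k) + n * k) → Fin (n + k) × Fin (n + k)
  borderCell = [ bottomCell , rightCell ]′ ∘ splitAt (k * (n + k))

  borderCell-injective : Injective _≡_ _≡_ borderCell
  borderCell-injective = [,]∘splitAt-injective bottomCell-injective rightCell-injective bottom≢right
    where
    bottomCell-injective : Injective _≡_ _≡_ bottomCell
    bottomCell-injective eq = remQuot-injective {k} (n + k)
      (×-≡,≡→≡ (↑ʳ-injective n _ _ (,-injectiveˡ eq) , ,-injectiveʳ eq))
    rightCell-injective : Injective _≡_ _≡_ rightCell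
    rightCell-injective eq = remQuot-injective {n} k
      (×-≡,≡→≡ (↑ˡ-injective k _ _ (,-injectiveˡ eq) , ↑ʳ-injective n _ _ (,-injectiveʳ eq)))
    bottom≢right : ∀ u v → bottomCell u ≢ rightCell v
    bottom≢right u v eq = ↑ˡ≢↑ʳ _ _ (sym (,-injectiveˡ eq))

  bordered-border : ∀ u → uncurry bordered (borderCell u) ≡ oddCode (borderCell u)
  bordered-border u with splitAt (k * (n + k)) u
  ... | inj₁ v rewrite splitAt-↑ʳ n k (proj₁ (remQuot {k} (n + k) v)) = refl
  ... | inj₂ v rewrite splitAt-↑ˡ n (proj₁ (remQuot {n} k v)) k
                     | splitAt-↑ʳ n k (proj₂ (remQuot {n} k v)) = refl

  bordered-symbols : AtLeastSymbols n A → AtLeastSymbols (n + (k * (n + k) + n * k)) bordered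
  bordered-symbols (r , c , distinct) =
    atLeastSymbols-+ {B = bordered} coreCell borderCell coreCell-distinct borderCell-distinct core≢border
    where
    coreCell : Fin n → Fin (n + k) × Fin (n + k)
    coreCell t = r t ↑ˡ k , c t ↑ˡ k
    coreCell-distinct : Injective _≡_ _≡_ (uncurry bordered ∘ coreCell)
    coreCell-distinct {s} {t} eq = distinct (*-cancelˡ-≡ _ _ 2
      (trans (sym (bordered-core (r s) (c s))) (trans eq (bordered-core (r t) (c t)))))
    borderCell-distinct : Injective _≡_ _≡_ (uncurry bordered ∘ borderCell)
    borderCell-distinct {u} {v} eq = borderCell-injective (oddCode-injective
      (trans (sym (bordered-border u)) (trans eq (bordered-border v))))
    core≢border : ∀ t u → uncurry bordered (coreCell t) ≢ uncurry bordered (borderCell u)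
    core≢border t u eq = even≢odd (A (r t) (c t)) (toℕ (uncurry combine (borderCell u)))
      (trans (sym (bordered-core (r t) (c t))) (trans eq (bordered-border u)))

≤-borderedSymbolCount : ∀ {ℓ} n k →
  ℓ + k * k + k ≤ 2 * k * (n + k) + (n + k) → ℓ ≤ n + (k * (n + k) + n * k)
≤-borderedSymbolCount {ℓ} n k ℓ+k²+k≤ =
  +-cancelʳ-≤ (k * k) ℓ _ (+-cancelʳ-≤ k _ _ (≤-trans ℓ+k²+k≤ (≤-reflexive (identity n k))))
  where
  open +-*-Solver
  identity : ∀ n k → 2 * k * (n + k) + (n + k) ≡ n + (k * (n + k) + n * k) + k * k + k
  identity = solve 2 (λ n k → con 2 :* k :* (n :+ k) :+ (n :+ k)
                           := n :+ (k :* (n :+ k) :+ n :* k) :+ k :* k :+ k) refl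

proposition3 : (k : ℕ) →
    (∀ (n : ℕ) → 1 ≤ n → ∃ λ ℓn → IsEll n ℓn × ℓn + k * k + k ≤ 2 * k * n + n) →
    ∀ (n : ℕ) (A : Array n) → IsLatinSquare A → HasPartialTransversal (n ∸ k) A
proposition3 k _ zero A _ =
  subst (λ L → HasPartialTransversal L A) (sym (0∸n≡0 k)) (empty-partialTransversal A)
proposition3 k ℓ-bound n@(suc _) A (latin , symbols , _) =
  let ℓ , (_ , _ , has-transversal , _) , ℓ-small = ℓ-bound (n + k) (s≤s z≤n)
      transversal : HasTransversal (bordered A k)
      transversal = has-transversal (bordered A k) (bordered-isLatin A k latin)
        (atLeastSymbols-≤ {B = bordered A k} (≤-borderedSymbolCount n k ℓ-small)
          (bordered-symbols A k symbols))
  in subst (λ L → HasPartialTransversal L A) (cong (_∸ k) (m+n∸n≡m n k))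
       (partialTransversal-comap {A = A} {topLeft k (bordered A k)} (2 *_) (bordered-core A k)
         (partialTransversal-topLeft (bordered A k) transversal))
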